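{- Let $f$ be a multiplicative function and let $p$ be a prime number. Let $\kappa_0=0,\kappa_1,\kappa_2,\dots$ be a sequence of complex numbers, and let $a_1,a_2,\dots$ be a sequence of positive integers with $a_\alpha\le\alpha$ for every $\alpha\ge1$. Then the function defined for positive integers $n$ by \[ h^{(1)}_{f,p}(n)=\xi_f(n)-\kappa_{v_p(n)}\sum_{\substack{1\le k\le n\\ v_p(k)=v_p(n)-a_{v_p(n)}}} f\bigl((k,n)\bigr), \qquad\text{where } \xi_f(n)=\sum_{k=1}^n f\bigl((k,n)\bigr), \] is multiplicative. (When $v_p(n)=0$ the second term is absent since $\kappa_0=0$.)
   Context: An arithmetic function is a complex-valued function on the positive integers; it is multiplicative if it is not identically zero and $f(mn)=f(m)f(n)$ whenever $(m,n)=1$, where $(m,n)$ denotes the greatest common divisor. For a prime $p$ and positive integer $n$, $v_p(n)$ is the exponent $\alpha$ such that $p^\alpha\mid n$ but $p^{\alpha+1}\nmid n$. -}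

module Defs where

open import Level using (Level)
open import Data.Nat using (ℕ; zero; suc; _∸_; _≤_; _/_; _≡ᵇ_) renaming (_*_ to _*ℕ_)
open import Data.Product using (_×_)
open import Data.Nat.Divisibility using (_∣?_)
open import Data.Nat.GCD using (gcd)
open import Data.Nat.Coprimality using (Coprime)
open import Data.Bool using (if_then_else_)
open import Relation.Nullary using (¬_; yes; no)
open import Algebra.Bundles using (CommutativeRing)

-- p-adic valuation v_p(n) (with fuel; fuel n suffices for n ≥ 1, p ≥ 2).
-- Conventions for p = 0 or n = 0 are irrelevant (p is prime, n ≥ 1).
valAux : ℕ → ℕ → ℕ → ℕ
valAux zero    p       n = 0
valAux (suc k) zero    n = 0
valAux (suc k) (suc q) zero = 0
valAux (suc k) (suc q) (suc m) with suc q ∣? suc m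
... | yes _ = suc (valAux k (suc q) (suc m / suc q))
... | no  _ = 0

v : ℕ → ℕ → ℕ
v p n = valAux n p n

module _ {c ℓ : Level} (R : CommutativeRing c ℓ) where
  open CommutativeRing R

  sumTo : ℕ → (ℕ → Carrier) → Carrier
  sumTo zero    g = 0#
  sumTo (suc n) g = sumTo n g + g (suc n)

  Multiplicative : (ℕ → Carrier) → Set ℓ
  Multiplicative f =
    (¬ (∀ n → 1 ≤ n → f n ≈ 0#))  ×
    (∀ m n → 1 ≤ m → 1 ≤ n → Coprime m n → f (m *ℕ n) ≈ f m * f n)

  ξ : (ℕ → Carrier) → ℕ → Carrier
  ξ f n = sumTo n (λ k → f (gcd k n))

  h1 : (ℕ → Carrier) → ℕ → (ℕ → Carrier) → (ℕ → ℕ) → ℕ → Carrier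
  h1 f p κ a n =
    ξ f n - κ (v p n) *
      sumTo n (λ k → if v p k ≡ᵇ (v p n ∸ a (v p n)) then f (gcd k n) else 0#)

module Submission where

-- The function h = h⁽¹⁾_{f,p} is  h(N) = ξ(N) − κ_{v_p N} · ξ_{β(N)}(N),  where
-- ξ_β(N) = Σ_{k ≤ N, v_p k = β} f((k,N)) and β(N) = v_p N − a_{v_p N}.
--
-- Both ξ and ξ_β are instances of a "restricted" sum ξ[P](N) = Σ_{k ≤ N, P k} f((k,N)).
-- If m and n are coprime and the test P only depends on k mod n, the Chinese
-- remainder theorem splits the sum over k ≤ mn into a product, giving
--     ξ[P](mn) = ξ(m) · ξ[P](n).                                              (★)
-- For P = "always" this is the multiplicativity of ξ.  For P = "v_p k = β" the
-- test depends only on k mod n as soon as p^{β+1} ∣ n; this holds for β = β(n)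
-- because 1 ≤ a_α ≤ α forces β(n) < v_p n.  Hence, when p ∤ m, (★) gives
-- h(mn) = ξ(m) h(n) = h(m) h(n) (the correction term of h(m) vanishes since κ₀ = 0).
-- A prime cannot divide both of two coprime numbers, which yields multiplicativity.

open import Defs
open import Level using (Level)
open import Algebra.Bundles using (CommutativeRing)
open import Data.Bool using (Bool; true; false; if_then_else_)
open import Data.Empty using (⊥; ⊥-elim)
open import Data.Fin using (Fin; toℕ; fromℕ<; punchOut)
open import Data.Fin.Properties
  using (toℕ<n; toℕ-fromℕ<; toℕ-injective; toℕ-inject₁; toℕ-fromℕ; any?; punchOut-injective; injective⇒≤)
  renaming (_≟_ to _≟ᶠ_)
open import Data.Fin.Permutation using (Permutation; permutation)
open import Data.Nat
  using (ℕ; zero; suc; _+_; _*_; _∸_; _^_; _%_; _/_; _≤_; _<_; _≡ᵇ_; z≤n; s≤s; NonZero; NonTrivial; >-nonZero; >-nonZero⁻¹; nonTrivial⇒≢1)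
import Data.Nat.Properties as ℕₚ
open import Data.Nat.DivMod using (m≡m%n+[m/n]*n; m%n<n; [m+kn]%n≡m%n; m<n⇒m%n≡m; m∣n⇒o%n%m≡o%m; m/n<m; m*[n/m]≡n)
open import Data.Nat.Divisibility
  using (_∣_; _∣?_; divides; divides-refl; 1∣_; ∣-refl; ∣-trans; ∣-antisym; n∣m*n; m∣m*n; ∣n⇒∣m*n;
         *-pres-∣; *-monoʳ-∣; *-cancelˡ-∣; ∣m+n∣m⇒∣n; ∣n∣m%n⇒∣m; %-presˡ-∣; n∣m⇒m%n≡0)
open import Data.Nat.GCD using (gcd; gcd[m,n]∣m; gcd[m,n]∣n; gcd-greatest; gcd[m,n]≢0; gcd-zeroʳ; c*gcd[m,n]≡gcd[cm,cn])
open import Data.Nat.Coprimality using (Coprime; coprime-divisor; 1-coprimeTo)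
import Data.Nat.Coprimality as Coprime
open import Data.Nat.Primality using (Prime; prime⇒nonTrivial; prime⇒irreducible)
open import Data.Product using (_×_; _,_; proj₁; proj₂; ∃)
open import Data.Sum using (_⊎_; inj₁; inj₂)
open import Function using (_∘_; _⇔_; mk⇔)
open import Function.Definitions using (Injective)
import Function.Properties.Equivalence as ⇔
open import Relation.Binary using (tri<; tri≈; tri>)
open import Relation.Nullary using (¬_; yes; no; does; ¬?; _×-dec_; Dec)
open import Relation.Nullary.Decidable using (does-⇔)
open import Relation.Nullary.Negation using (contradiction)
open import Relation.Binary.PropositionalEquality as ≡ using (_≡_; refl; cong; cong₂; subst)

gcd-% : ∀ k n .{{_ : NonZero n}} → gcd (k % n) n ≡ gcd k n
gcd-% k n = ∣-antisym
  (gcd-greatest (∣n∣m%n⇒∣m (gcd[m,n]∣n (k % n) n) (gcd[m,n]∣m (k % n) n)) (gcd[m,n]∣n (k % n) n))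
  (gcd-greatest (%-presˡ-∣ (gcd[m,n]∣m k n) (gcd[m,n]∣n k n)) (gcd[m,n]∣n k n))

gcd-pos : ∀ k {n} → 1 ≤ n → 1 ≤ gcd k n
gcd-pos k {n} n≥1 = ℕₚ.n≢0⇒n>0 (gcd[m,n]≢0 k n (inj₂ (ℕₚ.n>0⇒n≢0 n≥1)))

coprime-∣-* : ∀ {m n k} → Coprime m n → m ∣ k → n ∣ k → m * n ∣ k
coprime-∣-* {m} {n} cop (divides-refl q) n∣qm =
  subst (m * n ∣_) (ℕₚ.*-comm m q)
    (*-monoʳ-∣ m (coprime-divisor (Coprime.sym cop) (subst (n ∣_) (ℕₚ.*-comm q m) n∣qm)))

gcd-*-coprime : ∀ k {m n} → Coprime m n → gcd k (m * n) ≡ gcd k m * gcd k n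
gcd-*-coprime k {m} {n} cop = ∣-antisym g∣d₁d₂ d₁d₂∣g
  where
  g d₁ d₂ : ℕ
  g = gcd k (m * n)
  d₁ = gcd k m
  d₂ = gcd k n
  coprime-d : Coprime d₁ d₂
  coprime-d (i∣d₁ , i∣d₂) = cop (∣-trans i∣d₁ (gcd[m,n]∣n k m) , ∣-trans i∣d₂ (gcd[m,n]∣n k n))
  d₁d₂∣g : d₁ * d₂ ∣ g
  d₁d₂∣g = gcd-greatest (coprime-∣-* coprime-d (gcd[m,n]∣m k m) (gcd[m,n]∣m k n))
                        (*-pres-∣ (gcd[m,n]∣n k m) (gcd[m,n]∣n k n))
  -- g divides m·d₂ = gcd(mk, mn), hence also d₂·d₁ = gcd(d₂k, d₂m).
  g∣k : g ∣ k
  g∣k = gcd[m,n]∣m k (m * n)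
  g∣md₂ : g ∣ m * d₂
  g∣md₂ = subst (g ∣_) (≡.sym (c*gcd[m,n]≡gcd[cm,cn] m k n))
                (gcd-greatest (∣n⇒∣m*n m g∣k) (gcd[m,n]∣n k (m * n)))
  g∣d₂d₁ : g ∣ d₂ * d₁
  g∣d₂d₁ = subst (g ∣_) (≡.sym (c*gcd[m,n]≡gcd[cm,cn] d₂ k m))
                 (gcd-greatest (∣n⇒∣m*n d₂ g∣k) (subst (g ∣_) (ℕₚ.*-comm m d₂) g∣md₂))
  g∣d₁d₂ : g ∣ d₁ * d₂
  g∣d₁d₂ = subst (g ∣_) (ℕₚ.*-comm d₂ d₁) g∣d₂d₁

^-monoʳ-∣ : ∀ p {i j} → i ≤ j → p ^ i ∣ p ^ j
^-monoʳ-∣ p {i} {j} i≤j = divides (p ^ (j ∸ i)) (begin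
  p ^ j                 ≡⟨ cong (p ^_) (≡.sym (ℕₚ.m+[n∸m]≡n i≤j)) ⟩
  p ^ (i + (j ∸ i))     ≡⟨ ℕₚ.^-distribˡ-+-* p i (j ∸ i) ⟩
  p ^ i * p ^ (j ∸ i)   ≡⟨ ℕₚ.*-comm (p ^ i) _ ⟩
  p ^ (j ∸ i) * p ^ i   ∎)
  where open ≡.≡-Reasoning

prime-∤⇒coprime : ∀ {p m} → Prime p → ¬ (p ∣ m) → Coprime p m
prime-∤⇒coprime pp p∤m {d} (d∣p , d∣m) with prime⇒irreducible pp d∣p
... | inj₁ d≡1 = d≡1
... | inj₂ refl = contradiction d∣m p∤m

prime-coprime-split : ∀ {p m n} → Prime p → Coprime m n → Coprime p m ⊎ Coprime p n
prime-coprime-split {p} {m} {n} pp cop with p ∣? m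
... | no p∤m = inj₁ (prime-∤⇒coprime pp p∤m)
... | yes p∣m = inj₂ (prime-∤⇒coprime pp λ p∣n →
  nonTrivial⇒≢1 {{prime⇒nonTrivial pp}} (cop (p∣m , p∣n)))

%-+-stable⇒∣ : ∀ x y n .{{_ : NonZero n}} → (x + y) % n ≡ x % n → n ∣ y
%-+-stable⇒∣ x y n eq = ∣m+n∣m⇒∣n (divides ((x + y) / n) (ℕₚ.+-cancelˡ-≡ (x % n) _ _ (begin
  x % n + ((x / n) * n + y)        ≡⟨ ≡.sym (ℕₚ.+-assoc (x % n) _ y) ⟩
  x % n + (x / n) * n + y          ≡⟨ cong (_+ y) (≡.sym (m≡m%n+[m/n]*n x n)) ⟩
  x + y                            ≡⟨ m≡m%n+[m/n]*n (x + y) n ⟩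
  (x + y) % n + ((x + y) / n) * n  ≡⟨ cong (_+ ((x + y) / n) * n) eq ⟩
  x % n + ((x + y) / n) * n        ∎))) (n∣m*n (x / n))
  where open ≡.≡-Reasoning

-- Injectivity of j ↦ (i + m j) mod n in the ordered case a ≤ b < n: from
-- n ∣ m (b − a) and (m, n) = 1 we get n ∣ b − a < n, so b − a = 0.
affine-%-injective-≤ : ∀ n .{{_ : NonZero n}} {m} i → Coprime m n → ∀ {a b} → a ≤ b → b < n →
                       (i + m * a) % n ≡ (i + m * b) % n → a ≡ b
affine-%-injective-≤ n {m} i cop {a} {b} a≤b b<n eq =
  ≡.trans (≡.sym (ℕₚ.+-identityʳ a)) (≡.trans (cong (a +_) (≡.sym d≡0)) (ℕₚ.m+[n∸m]≡n a≤b))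
  where
  open ≡.≡-Reasoning
  d : ℕ
  d = b ∸ a
  i+mb : i + m * b ≡ (i + m * a) + m * d
  i+mb = begin
    i + m * b            ≡⟨ cong (λ t → i + m * t) (≡.sym (ℕₚ.m+[n∸m]≡n a≤b)) ⟩
    i + m * (a + d)      ≡⟨ cong (i +_) (ℕₚ.*-distribˡ-+ m a d) ⟩
    i + (m * a + m * d)  ≡⟨ ≡.sym (ℕₚ.+-assoc i _ _) ⟩
    i + m * a + m * d    ∎
  n∣d : n ∣ d
  n∣d = coprime-divisor (Coprime.sym cop)
          (%-+-stable⇒∣ (i + m * a) (m * d) n (≡.trans (cong (_% n) (≡.sym i+mb)) (≡.sym eq)))
  d≡0 : d ≡ 0
  d≡0 = ≡.trans (≡.sym (m<n⇒m%n≡m (ℕₚ.≤-<-trans (ℕₚ.m∸n≤m b a) b<n))) (n∣m⇒m%n≡0 d n n∣d)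

affine-%-injective : ∀ n .{{_ : NonZero n}} {m} i → Coprime m n → ∀ {a b} → a < n → b < n →
                     (i + m * a) % n ≡ (i + m * b) % n → a ≡ b
affine-%-injective n i cop {a} {b} a<n b<n eq with ℕₚ.≤-total a b
... | inj₁ a≤b = affine-%-injective-≤ n i cop a≤b b<n eq
... | inj₂ b≤a = ≡.sym (affine-%-injective-≤ n i cop b≤a a<n (≡.sym eq))

injective⇒surjective : ∀ {n} (σ : Fin n → Fin n) → Injective _≡_ _≡_ σ → ∀ r → ∃ λ j → σ j ≡ r
injective⇒surjective {suc n} σ σ-inj r with any? (λ j → σ j ≟ᶠ r)
... | yes hit = hit
... | no miss = contradiction (injective⇒≤ τ-inj) ℕₚ.1+n≰n
  where
  -- Missing r, σ would squeeze Fin (suc n) injectively into Fin n.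
  σ≢r : ∀ j → r ≡ σ j → ⊥
  σ≢r j eq = miss (j , ≡.sym eq)
  τ : Fin (suc n) → Fin n
  τ j = punchOut (σ≢r j)
  τ-inj : Injective _≡_ _≡_ τ
  τ-inj {x} {y} eq = σ-inj (punchOut-injective (σ≢r x) (σ≢r y) eq)

module Valuation (q : ℕ) where

  p : ℕ
  p = suc (suc q)

  ExactPower : ℕ → ℕ → Set
  ExactPower β k = p ^ β ∣ k × ¬ (p ^ suc β ∣ k)

  exactPower? : ∀ β k → Dec (ExactPower β k)
  exactPower? β k = (p ^ β ∣? k) ×-dec ¬? (p ^ suc β ∣? k)

  valAux-exact : ∀ fuel k → 1 ≤ k → k ≤ fuel → ExactPower (valAux fuel p k) k
  valAux-exact (suc fuel) (suc k) _ (s≤s k≤fuel) with p ∣? suc k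
  ... | no p∤k = 1∣ suc k , λ p∣k → p∤k (subst (_∣ suc k) (ℕₚ.*-identityʳ p) p∣k)
  ... | yes p∣k = subst (p ^ suc γ ∣_) k≡ (*-monoʳ-∣ p (proj₁ IH)) ,
                  λ h → proj₂ IH (*-cancelˡ-∣ p (subst (p ^ suc (suc γ) ∣_) (≡.sym k≡) h))
    where
    k′ : ℕ
    k′ = suc k / p
    k≡ : p * k′ ≡ suc k
    k≡ = m*[n/m]≡n p∣k
    k′≥1 : 1 ≤ k′
    k′≥1 = ℕₚ.n≢0⇒n>0 λ k′≡0 →
      ℕₚ.0≢1+n (≡.trans (≡.sym (ℕₚ.*-zeroʳ p)) (≡.trans (cong (p *_) (≡.sym k′≡0)) k≡))
    k′≤fuel : k′ ≤ fuel
    k′≤fuel = ℕₚ.≤-pred (ℕₚ.≤-trans (m/n<m (suc k) p (s≤s (s≤s z≤n))) (s≤s k≤fuel))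
    γ : ℕ
    γ = valAux fuel p k′
    IH : ExactPower γ k′
    IH = valAux-exact fuel k′ k′≥1 k′≤fuel

  v-exact : ∀ {k} → 1 ≤ k → ExactPower (v p k) k
  v-exact {k} k≥1 = valAux-exact k k k≥1 ℕₚ.≤-refl

  exactPower-unique : ∀ {β γ k} → ExactPower β k → ExactPower γ k → β ≡ γ
  exactPower-unique {β} {γ} (β∣ , β+1∤) (γ∣ , γ+1∤) with ℕₚ.<-cmp β γ
  ... | tri< β<γ _ _ = contradiction (∣-trans (^-monoʳ-∣ p β<γ) γ∣) β+1∤
  ... | tri≈ _ β≡γ _ = β≡γ
  ... | tri> _ _ γ<β = contradiction (∣-trans (^-monoʳ-∣ p γ<β) β∣) γ+1∤

  v≡⇔exactPower : ∀ {k β} → 1 ≤ k → (v p k ≡ β) ⇔ ExactPower β k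
  v≡⇔exactPower k≥1 = mk⇔ (λ { refl → v-exact k≥1 }) (exactPower-unique (v-exact k≥1))

  exactPower-% : ∀ {β n} k .{{_ : NonZero n}} → p ^ suc β ∣ n → ExactPower β (k % n) ⇔ ExactPower β k
  exactPower-% {β} {n} k p^β+1∣n = mk⇔
    (λ (β∣ , β+1∤) → ∣n∣m%n⇒∣m p^β∣n β∣ , λ β+1∣ → β+1∤ (%-presˡ-∣ β+1∣ p^β+1∣n))
    (λ (β∣ , β+1∤) → %-presˡ-∣ β∣ p^β∣n , λ β+1∣ → β+1∤ (∣n∣m%n⇒∣m p^β+1∣n β+1∣))
    where
    p^β∣n : p ^ β ∣ n
    p^β∣n = ∣-trans (^-monoʳ-∣ p (ℕₚ.n≤1+n β)) p^β+1∣n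

  v≡ᵇ-% : ∀ {β n} k .{{_ : NonZero n}} → 1 ≤ k → p ^ suc β ∣ n →
          (v p k ≡ᵇ β) ≡ does (exactPower? β (k % n))
  v≡ᵇ-% {β} {n} k k≥1 p^β+1∣n = does-⇔
    (⇔.trans (v≡⇔exactPower k≥1) (⇔.sym (exactPower-% {β} {n} k p^β+1∣n)))
    (v p k ℕₚ.≟ β) (exactPower? β (k % n))

  coprime-pow-divisor : ∀ {m} → Coprime p m → ∀ j {x} → p ^ j ∣ m * x → p ^ j ∣ x
  coprime-pow-divisor cop zero {x} _ = 1∣ x
  coprime-pow-divisor {m} cop (suc j) {x} h with coprime-divisor cop (∣-trans (m∣m*n (p ^ j)) h)
  ... | divides-refl y = subst (p ^ suc j ∣_) (ℕₚ.*-comm p y) (*-monoʳ-∣ p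
          (coprime-pow-divisor cop j (*-cancelˡ-∣ p (subst (p ^ suc j ∣_) (m[yp]≡p[my] y) h))))
    where
    m[yp]≡p[my] : ∀ y → m * (y * p) ≡ p * (m * y)
    m[yp]≡p[my] y = ≡.trans (≡.sym (ℕₚ.*-assoc m y p)) (ℕₚ.*-comm (m * y) p)

  v-*-coprime : ∀ {m n} → Coprime p m → 1 ≤ m → 1 ≤ n → v p (m * n) ≡ v p n
  v-*-coprime {m} {n} cop m≥1 n≥1 = exactPower-unique (v-exact (ℕₚ.*-mono-≤ m≥1 n≥1))
    (∣n⇒∣m*n m (proj₁ (v-exact n≥1)) , λ h → proj₂ (v-exact n≥1) (coprime-pow-divisor cop (suc (v p n)) h))

  v-coprime : ∀ {m} → Coprime p m → 1 ≤ m → v p m ≡ 0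
  v-coprime {m} cop m≥1 = exactPower-unique (v-exact m≥1)
    (1∣ m , λ p∣m → contradiction (cop (∣-refl , subst (_∣ m) (ℕₚ.*-identityʳ p) p∣m)) λ ())

-- Finite sums Σ n g = g 0 + … + g (n − 1) in a commutative ring: reindexing by
-- permutations of residues, and the Chinese remainder theorem.
module Sums {c ℓ : Level} (R : CommutativeRing c ℓ) where

  open CommutativeRing R renaming (_+_ to _+ᴿ_; _*_ to _*ᴿ_; refl to ≈-refl; sym to ≈-sym; trans to ≈-trans)
  open import Algebra.Properties.Semiring.Sum semiring
    using (sum; sum-cong-≋; sum-cong-≗; sum-init-last; sum-permute; ∑-comm; *-distribˡ-sum; *-distribʳ-sum)
  open import Relation.Binary.Reasoning.Setoid setoid

  Σ : ℕ → (ℕ → Carrier) → Carrier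
  Σ n g = sum {n} (λ i → g (toℕ i))

  Σ-cong : ∀ n {g g′ : ℕ → Carrier} → (∀ j → j < n → g j ≈ g′ j) → Σ n g ≈ Σ n g′
  Σ-cong n g≈g′ = sum-cong-≋ {n} (λ i → g≈g′ (toℕ i) (toℕ<n i))

  Σ-snoc : ∀ n g → Σ (suc n) g ≈ Σ n g +ᴿ g n
  Σ-snoc n g = ≈-trans (sum-init-last {n} (λ i → g (toℕ i)))
    (+-cong (reflexive (sum-cong-≗ {n} (λ i → cong g (toℕ-inject₁ i)))) (reflexive (cong g (toℕ-fromℕ n))))

  sumTo-Σ : ∀ n g → sumTo R n g ≈ Σ n (λ k → g (suc k))
  sumTo-Σ zero g = ≈-refl
  sumTo-Σ (suc n) g = begin
    sumTo R n g +ᴿ g (suc n)            ≈⟨ +-congʳ (sumTo-Σ n g) ⟩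
    Σ n (λ k → g (suc k)) +ᴿ g (suc n)  ≈⟨ Σ-snoc n (λ k → g (suc k)) ⟨
    Σ (suc n) (λ k → g (suc k))         ∎

  Σ-++ : ∀ m n g → Σ (m + n) g ≈ Σ m g +ᴿ Σ n (λ k → g (m + k))
  Σ-++ zero n g = ≈-sym (+-identityˡ _)
  Σ-++ (suc m) n g = ≈-trans (+-congˡ (Σ-++ m n (g ∘ suc))) (≈-sym (+-assoc _ _ _))

  Σ-blocks : ∀ m n h → Σ (m * n) h ≈ Σ m (λ a → Σ n (λ b → h (a * n + b)))
  Σ-blocks zero n h = ≈-refl
  Σ-blocks (suc m) n h = begin
    Σ (n + m * n) h                                             ≈⟨ Σ-++ n (m * n) h ⟩
    Σ n h +ᴿ Σ (m * n) (λ k → h (n + k))                        ≈⟨ +-congˡ (Σ-blocks m n (λ k → h (n + k))) ⟩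
    Σ n h +ᴿ Σ m (λ a → Σ n (λ b → h (n + (a * n + b))))        ≈⟨ +-congˡ (reflexive (sum-cong-≗ {m} λ a →
                                                                     sum-cong-≗ {n} λ b → cong h (≡.sym (ℕₚ.+-assoc n _ _)))) ⟩
    Σ n h +ᴿ Σ m (λ a → Σ n (λ b → h (suc a * n + b)))          ∎

  sum-injective : ∀ {n} (σ : Fin n → Fin n) → Injective _≡_ _≡_ σ → (G : Fin n → Carrier) →
                  sum (G ∘ σ) ≈ sum G
  sum-injective {n} σ σ-inj G = ≈-sym (sum-permute G π)
    where
    surj : ∀ r → ∃ λ j → σ j ≡ r
    surj = injective⇒surjective σ σ-inj
    π : Permutation n n
    π = permutation σ (proj₁ ∘ surj) (proj₂ ∘ surj) (λ x → σ-inj (proj₂ (surj (σ x))))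

  Σ-affine : ∀ n .{{_ : NonZero n}} m i → Coprime m n → ∀ G → Σ n (λ j → G ((i + m * j) % n)) ≈ Σ n G
  Σ-affine n m i cop G = ≈-trans
    (reflexive (sum-cong-≗ {n} (λ j → cong G (≡.sym (toℕ-fromℕ< (m%n<n (i + m * toℕ j) n))))))
    (sum-injective σ σ-inj (λ r → G (toℕ r)))
    where
    σ : Fin n → Fin n
    σ j = fromℕ< (m%n<n (i + m * toℕ j) n)
    σ-inj : Injective _≡_ _≡_ σ
    σ-inj {x} {y} σx≡σy = toℕ-injective (affine-%-injective n i cop (toℕ<n x) (toℕ<n y)
      (≡.trans (≡.sym (toℕ-fromℕ< _)) (≡.trans (cong toℕ σx≡σy) (toℕ-fromℕ< _))))

  sumTo-periodic : ∀ N .{{_ : NonZero N}} (H Φ : ℕ → Carrier) → (∀ k → 1 ≤ k → H k ≈ Φ (k % N)) →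
                   sumTo R N H ≈ Σ N Φ
  sumTo-periodic N H Φ H≈Φ = begin
    sumTo R N H                        ≈⟨ sumTo-Σ N H ⟩
    Σ N (λ k → H (suc k))              ≈⟨ Σ-cong N (λ k _ → H≈Φ (suc k) (s≤s z≤n)) ⟩
    Σ N (λ k → Φ (suc k % N))          ≈⟨ reflexive (sum-cong-≗ {N} λ k → cong (λ t → Φ (suc t % N)) (≡.sym (ℕₚ.*-identityˡ (toℕ k)))) ⟩
    Σ N (λ k → Φ ((1 + 1 * k) % N))    ≈⟨ Σ-affine N 1 1 (1-coprimeTo N) Φ ⟩
    Σ N Φ                              ∎

  -- Chinese remainder theorem: k ↦ (k mod m, k mod n) identifies [0, mn) with [0, m) × [0, n).
  Σ-crt : ∀ m n .{{_ : NonZero m}} .{{_ : NonZero n}} → Coprime m n → ∀ g G →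
          Σ (m * n) (λ k → g (k % m) *ᴿ G (k % n)) ≈ Σ m g *ᴿ Σ n G
  Σ-crt m n cop g G = begin
    Σ (m * n) (λ k → g (k % m) *ᴿ G (k % n))                        ≈⟨ Σ-blocks m n (λ k → g (k % m) *ᴿ G (k % n)) ⟩
    Σ m (λ a → Σ n (λ b → g ((a * n + b) % m) *ᴿ G ((a * n + b) % n)))
      ≈⟨ Σ-cong m (λ a _ → Σ-cong n (λ b b<n → reflexive (cong₂ (λ x y → g x *ᴿ G y) (%m a b) (%n a b<n)))) ⟩
    Σ m (λ a → Σ n (λ b → g ((b + n * a) % m) *ᴿ G b))               ≈⟨ ∑-comm {m} {n} (λ a b → g ((toℕ b + n * toℕ a) % m) *ᴿ G (toℕ b)) ⟩
    Σ n (λ b → Σ m (λ a → g ((b + n * a) % m) *ᴿ G b))               ≈⟨ sum-cong-≋ {n} (λ b → *-distribʳ-sum {m} (G (toℕ b)) _) ⟨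
    Σ n (λ b → Σ m (λ a → g ((b + n * a) % m)) *ᴿ G b)               ≈⟨ sum-cong-≋ {n} (λ b → *-congʳ (Σ-affine m n (toℕ b) (Coprime.sym cop) g)) ⟩
    Σ n (λ b → Σ m g *ᴿ G b)                                         ≈⟨ *-distribˡ-sum {n} (Σ m g) (λ b → G (toℕ b)) ⟨
    Σ m g *ᴿ Σ n G                                                   ∎
    where
    %m : ∀ a b → (a * n + b) % m ≡ (b + n * a) % m
    %m a b = cong (_% m) (≡.trans (ℕₚ.+-comm (a * n) b) (cong (b +_) (ℕₚ.*-comm a n)))
    %n : ∀ a {b} → b < n → (a * n + b) % n ≡ b
    %n a {b} b<n = ≡.trans (cong (_% n) (ℕₚ.+-comm (a * n) b)) (≡.trans ([m+kn]%n≡m%n b a n) (m<n⇒m%n≡m b<n))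

MultiplicativeLaw : {c ℓ : Level} (R : CommutativeRing c ℓ) → (ℕ → CommutativeRing.Carrier R) → Set ℓ
MultiplicativeLaw R g = ∀ m n → 1 ≤ m → 1 ≤ n → Coprime m n →
  CommutativeRing._≈_ R (g (m * n)) (CommutativeRing._*_ R (g m) (g n))

module Multiplicativity {c ℓ : Level} (R : CommutativeRing c ℓ) where

  open CommutativeRing R using (_≈_; 0#; setoid; *-comm; *-congˡ; zeroʳ) renaming (_*_ to _*ᴿ_)
  open import Relation.Binary.Reasoning.Setoid setoid

  law-vanishing-at-1 : ∀ {g} → MultiplicativeLaw R g → g 1 ≈ 0# → ∀ n → 1 ≤ n → g n ≈ 0#
  law-vanishing-at-1 {g} g-law g1≈0 n n≥1 = begin
    g n           ≡⟨ cong g (≡.sym (ℕₚ.*-identityʳ n)) ⟩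
    g (n * 1)     ≈⟨ g-law n 1 n≥1 (s≤s z≤n) (Coprime.sym (1-coprimeTo n)) ⟩
    g n *ᴿ g 1    ≈⟨ *-congˡ g1≈0 ⟩
    g n *ᴿ 0#     ≈⟨ zeroʳ (g n) ⟩
    0#            ∎

  law-from-coprime-to-prime : ∀ {g p} → Prime p →
    (∀ m n → Coprime p m → 1 ≤ m → 1 ≤ n → Coprime m n → g (m * n) ≈ g m *ᴿ g n) →
    MultiplicativeLaw R g
  law-from-coprime-to-prime {g} {p} pp g-law m n m≥1 n≥1 cop with prime-coprime-split pp cop
  ... | inj₁ p⊥m = g-law m n p⊥m m≥1 n≥1 cop
  ... | inj₂ p⊥n = begin
    g (m * n)    ≡⟨ cong g (ℕₚ.*-comm m n) ⟩
    g (n * m)    ≈⟨ g-law n m p⊥n n≥1 m≥1 (Coprime.sym cop) ⟩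
    g n *ᴿ g m   ≈⟨ *-comm (g n) (g m) ⟩
    g m *ᴿ g n   ∎

module RestrictedSums {c ℓ : Level} (R : CommutativeRing c ℓ)
  (f : ℕ → CommutativeRing.Carrier R) (f-law : MultiplicativeLaw R f) where

  open CommutativeRing R hiding (refl; trans) renaming (_+_ to _+ᴿ_; _*_ to _*ᴿ_; sym to ≈-sym)
  open Sums R
  open Multiplicativity R using (law-from-coprime-to-prime)
  open import Relation.Binary.Reasoning.Setoid setoid

  -- ξ f N is ξ[P] N for the test P that always succeeds, definitionally.
  ξ[_] : (ℕ → Bool) → ℕ → Carrier
  ξ[ P ] N = sumTo R N (λ k → if P k then f (gcd k N) else 0#)

  f-gcd-split : ∀ {m n} .{{_ : NonZero m}} .{{_ : NonZero n}} → Coprime m n →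
                ∀ k → f (gcd k (m * n)) ≈ f (gcd (k % m) m) *ᴿ f (gcd (k % n) n)
  f-gcd-split {m} {n} cop k = begin
    f (gcd k (m * n))                         ≡⟨ cong f (gcd-*-coprime k cop) ⟩
    f (gcd k m * gcd k n)                     ≈⟨ f-law _ _ (gcd-pos k (>-nonZero⁻¹ m)) (gcd-pos k (>-nonZero⁻¹ n)) coprime-gcds ⟩
    f (gcd k m) *ᴿ f (gcd k n)                ≡⟨ cong₂ (λ x y → f x *ᴿ f y) (≡.sym (gcd-% k m)) (≡.sym (gcd-% k n)) ⟩
    f (gcd (k % m) m) *ᴿ f (gcd (k % n) n)    ∎
    where
    coprime-gcds : Coprime (gcd k m) (gcd k n)
    coprime-gcds (i∣d₁ , i∣d₂) = cop (∣-trans i∣d₁ (gcd[m,n]∣n k m) , ∣-trans i∣d₂ (gcd[m,n]∣n k n))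

  select-scale : ∀ b {x y z} → x ≈ y *ᴿ z → (if b then x else 0#) ≈ y *ᴿ (if b then z else 0#)
  select-scale true x≈yz = x≈yz
  select-scale false {y = y} _ = ≈-sym (zeroʳ y)

  ξ[]-split : ∀ {m n} .{{_ : NonZero m}} .{{_ : NonZero n}} → Coprime m n → (P P′ : ℕ → Bool) →
              (∀ k → 1 ≤ k → P k ≡ P′ (k % n)) → ξ[ P ] (m * n) ≈ ξ R f m *ᴿ ξ[ P ] n
  ξ[]-split {m} {n} cop P P′ P≡P′ = begin
    ξ[ P ] (m * n)                          ≈⟨ sumTo-periodic (m * n) _ (λ r → φ (r % m) *ᴿ χ (r % n)) periodic ⟩
    Σ (m * n) (λ r → φ (r % m) *ᴿ χ (r % n)) ≈⟨ Σ-crt m n cop φ χ ⟩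
    Σ m φ *ᴿ Σ n χ                          ≈⟨ *-cong ξ-residues ξ[]-residues ⟨
    ξ R f m *ᴿ ξ[ P ] n                     ∎
    where
    instance
      mn≢0 : NonZero (m * n)
      mn≢0 = ℕₚ.m*n≢0 m n
    φ χ : ℕ → Carrier
    φ r = f (gcd r m)
    χ r = if P′ r then f (gcd r n) else 0#
    ξ-residues : ξ R f m ≈ Σ m φ
    ξ-residues = sumTo-periodic m _ φ (λ k _ → reflexive (cong f (≡.sym (gcd-% k m))))
    ξ[]-residues : ξ[ P ] n ≈ Σ n χ
    ξ[]-residues = sumTo-periodic n _ χ (λ k k≥1 →
      reflexive (cong₂ (λ b x → if b then x else 0#) (P≡P′ k k≥1) (cong f (≡.sym (gcd-% k n)))))
    periodic : ∀ k → 1 ≤ k → (if P k then f (gcd k (m * n)) else 0#) ≈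
                              φ (k % (m * n) % m) *ᴿ χ (k % (m * n) % n)
    periodic k k≥1 rewrite m∣n⇒o%n%m≡o%m m (m * n) k (m∣m*n n) | m∣n⇒o%n%m≡o%m n (m * n) k (n∣m*n m)
                         | P≡P′ k k≥1 = select-scale (P′ (k % n)) (f-gcd-split cop k)

  ξ-split : ∀ {m n} .{{_ : NonZero m}} .{{_ : NonZero n}} → Coprime m n → ξ R f (m * n) ≈ ξ R f m *ᴿ ξ R f n
  ξ-split cop = ξ[]-split cop (λ _ → true) (λ _ → true) (λ _ _ → refl)

  module TwistedFunction (q : ℕ) (κ : ℕ → Carrier) (a : ℕ → ℕ) (κ₀≈0 : κ 0 ≈ 0#)
    (a-pos : ∀ α → 1 ≤ α → 1 ≤ a α) (a-bounded : ∀ α → 1 ≤ α → a α ≤ α) where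

    open Valuation q
    open import Algebra.Properties.Ring ring using (-‿distribʳ-*)
    open import Algebra.Properties.CommutativeSemigroup *-commutativeSemigroup using (x∙yz≈y∙xz)

    h : ℕ → Carrier
    h = h1 R f p κ a

    target : ℕ → ℕ
    target α = α ∸ a α

    hasValuation : ℕ → ℕ → Bool
    hasValuation β k = v p k ≡ᵇ β

    h-unfold : ∀ N {α} → v p N ≡ α → h N ≡ ξ R f N - κ α *ᴿ ξ[ hasValuation (target α) ] N
    h-unfold N refl = refl

    h-p-free : ∀ N → v p N ≡ 0 → h N ≈ ξ R f N
    h-p-free N vN≡0 = begin
      h N                             ≡⟨ h-unfold N vN≡0 ⟩
      ξ R f N +ᴿ - (κ 0 *ᴿ S)         ≈⟨ +-congˡ (-‿distribʳ-* (κ 0) S) ⟩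
      ξ R f N +ᴿ κ 0 *ᴿ - S           ≈⟨ +-congˡ (*-congʳ κ₀≈0) ⟩
      ξ R f N +ᴿ 0# *ᴿ - S            ≈⟨ +-congˡ (zeroˡ (- S)) ⟩
      ξ R f N +ᴿ 0#                   ≈⟨ +-identityʳ (ξ R f N) ⟩
      ξ R f N                         ∎
      where
      S : Carrier
      S = ξ[ hasValuation (target 0) ] N

    factor-out : ∀ x y z w → x *ᴿ y - z *ᴿ (x *ᴿ w) ≈ x *ᴿ (y - z *ᴿ w)
    factor-out x y z w = begin
      x *ᴿ y +ᴿ - (z *ᴿ (x *ᴿ w))     ≈⟨ +-congˡ (-‿cong (x∙yz≈y∙xz z x w)) ⟩
      x *ᴿ y +ᴿ - (x *ᴿ (z *ᴿ w))     ≈⟨ +-congˡ (-‿distribʳ-* x (z *ᴿ w)) ⟩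
      x *ᴿ y +ᴿ x *ᴿ - (z *ᴿ w)       ≈⟨ distribˡ x y (- (z *ᴿ w)) ⟨
      x *ᴿ (y +ᴿ - (z *ᴿ w))          ∎

    target<α : ∀ α → 1 ≤ α → target α < α
    target<α (suc α) α≥1 = ℕₚ.∸-monoʳ-< {suc α} {a (suc α)} {0} (a-pos (suc α) α≥1) (a-bounded (suc α) α≥1)

    h-split : ∀ {m n} → Coprime p m → 1 ≤ m → 1 ≤ n → Coprime m n → h (m * n) ≈ ξ R f m *ᴿ h n
    h-split {m} {n} p⊥m m≥1 n≥1 cop = by-valuation (v p n) refl
      where
      instance
        m≢0 : NonZero m
        m≢0 = >-nonZero m≥1
        n≢0 : NonZero n
        n≢0 = >-nonZero n≥1
      ξm : Carrier
      ξm = ξ R f m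
      by-valuation : ∀ α → v p n ≡ α → h (m * n) ≈ ξm *ᴿ h n
      by-valuation zero vn≡0 = begin
        h (m * n)            ≈⟨ h-p-free (m * n) (≡.trans (v-*-coprime p⊥m m≥1 n≥1) vn≡0) ⟩
        ξ R f (m * n)        ≈⟨ ξ-split cop ⟩
        ξm *ᴿ ξ R f n        ≈⟨ *-congˡ (h-p-free n vn≡0) ⟨
        ξm *ᴿ h n            ∎
      by-valuation (suc α) vn≡α = begin
        h (m * n)                                ≡⟨ h-unfold (m * n) (≡.trans (v-*-coprime p⊥m m≥1 n≥1) vn≡α) ⟩
        ξ R f (m * n) - κ (suc α) *ᴿ S (m * n)   ≈⟨ +-cong (ξ-split cop) (-‿cong (*-congˡ S-split)) ⟩
        ξm *ᴿ ξ R f n - κ (suc α) *ᴿ (ξm *ᴿ S n) ≈⟨ factor-out ξm (ξ R f n) (κ (suc α)) (S n) ⟩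
        ξm *ᴿ (ξ R f n - κ (suc α) *ᴿ S n)       ≡⟨ cong (ξm *ᴿ_) (h-unfold n vn≡α) ⟨
        ξm *ᴿ h n                                ∎
        where
        β : ℕ
        β = target (suc α)
        S : ℕ → Carrier
        S = ξ[ hasValuation β ]
        -- p^{β+1} divides p^{v_p n}, hence n, so the test "v_p k = β" only sees k mod n.
        p^β+1∣n : p ^ suc β ∣ n
        p^β+1∣n = ∣-trans (^-monoʳ-∣ p (target<α (suc α) (s≤s z≤n)))
                          (subst (λ γ → p ^ γ ∣ n) vn≡α (proj₁ (v-exact n≥1)))
        S-split : S (m * n) ≈ ξm *ᴿ S n
        S-split = ξ[]-split cop (hasValuation β) (does ∘ exactPower? β) (λ k k≥1 → v≡ᵇ-% k k≥1 p^β+1∣n)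

    -- h obeys the product law: reduce to p ∤ m, where h(m) = ξ(m).
    h-law : Prime p → MultiplicativeLaw R h
    h-law pp = law-from-coprime-to-prime pp λ m n p⊥m m≥1 n≥1 cop → begin
      h (m * n)          ≈⟨ h-split p⊥m m≥1 n≥1 cop ⟩
      ξ R f m *ᴿ h n     ≈⟨ *-congʳ (h-p-free m (v-coprime p⊥m m≥1)) ⟨
      h m *ᴿ h n         ∎

    h-at-1 : h 1 ≈ f 1
    h-at-1 = begin
      h 1                    ≈⟨ h-p-free 1 (v-coprime (Coprime.sym (1-coprimeTo p)) (s≤s z≤n)) ⟩
      0# +ᴿ f (gcd 1 1)      ≈⟨ +-identityˡ _ ⟩
      f (gcd 1 1)            ≡⟨ cong f (gcd-zeroʳ 1) ⟩
      f 1                    ∎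

theorem4 : {c ℓ : Level} (R : CommutativeRing c ℓ) →
    let open CommutativeRing R in
    (f : ℕ → Carrier) (p : ℕ) (κ : ℕ → Carrier) (a : ℕ → ℕ) →
    Multiplicative R f → Prime p → κ 0 ≈ 0# →
    (∀ α → 1 ≤ α → 1 ≤ a α) → (∀ α → 1 ≤ α → a α ≤ α) →
    Multiplicative R (h1 R f p κ a)
-- A prime is at least 2, so p = 2 + q.
theorem4 R f zero κ a _ pp _ _ _ = ⊥-elim (NonTrivial.nonTrivial (prime⇒nonTrivial pp))
theorem4 R f (suc zero) κ a _ pp _ _ _ = ⊥-elim (NonTrivial.nonTrivial (prime⇒nonTrivial pp))
theorem4 R f (suc (suc q)) κ a (f≢0 , f-law) pp κ₀≈0 a-pos a-bounded = h≢0 , h-law pp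
  where
  open CommutativeRing R using (_≈_; 0#; sym; trans)
  open Multiplicativity R using (law-vanishing-at-1)
  open RestrictedSums R f f-law
  open TwistedFunction q κ a κ₀≈0 a-pos a-bounded
  -- If h vanished on all n ≥ 1, then so would f, as f(1) = h(1).
  h≢0 : ¬ (∀ n → 1 ≤ n → h n ≈ 0#)
  h≢0 h≈0 = f≢0 (law-vanishing-at-1 f-law (trans (sym h-at-1) (h≈0 1 (s≤s z≤n))))
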